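{- Let $\mathcal{M}$ be a 3-orbit $(n-1)$-maniplex and $j\in\{0,\dots,n-1\}$. Then $\mathcal{M}$ is $j$-face-transitive if and only if $\mathcal{M}$ does not belong to any of the classes $3^j$, $3^{j,j+1}$ or $3^{j-1,j}$ (classes whose indices fall outside the allowed ranges are understood not to exist).
   Context: An $(n-1)$-maniplex is given by a connected simple graph (flag graph), whose vertices are called flags, with a proper edge-colouring by colours $\{0,\dots,n-1\}$, each colour class a perfect matching, such that for colours $i,j$ with $|i-j|\ge2$ each component of the subgraph spanned by colours $i,j$ is a 4-cycle. Automorphisms are colour-preserving graph automorphisms; $\mathcal{M}$ is 3-orbit if $\mathrm{Aut}(\mathcal{M})$ has exactly 3 orbits on flags. A $j$-face is a connected component of the flag graph with the $j$-edges removed; $\mathcal{M}$ is $j$-face-transitive if $\mathrm{Aut}(\mathcal{M})$ is transitive on $j$-faces. The symmetry type graph $T(\mathcal{M})$ has as vertices the flag orbits, an edge of colour $a$ between distinct orbits $B,C$ iff some flag of $B$ is $a$-adjacent to a flag of $C$, and a semi-edge of colour $a$ at $B$ iff some flag of $B$ is $a$-adjacent to a flag of $B$. A 3-orbit $(n-1)$-maniplex is in class $3^{j,j+1}$ ($j\in\{0,\dots,n-2\}$) if the vertices of $T(\mathcal{M})$ can be named $v_1,v_2,v_3$ so that its only (non-semi) edges are an edge of colour $j$ joining $v_1,v_2$ and an edge of colour $j+1$ joining $v_2,v_3$; it is in class $3^j$ ($j\in\{1,\dots,n-2\}$) if its only edges are an edge of colour $j$ joining $v_1,v_2$ and two edges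 of colours $j-1$ and $j+1$ joining $v_2,v_3$. Every 3-orbit maniplex is in exactly one of these classes. -}

module Defs where

open import Data.Nat using (ℕ; zero; suc; _≤_; _<_)
open import Data.Fin using (Fin; toℕ)
open import Data.Product using (Σ; ∃; _×_; _,_)
open import Data.Sum using (_⊎_)
open import Data.Unit using (⊤)
open import Relation.Nullary using (¬_)
open import Relation.Binary.PropositionalEquality using (_≡_; _≢_)
open import Function.Bundles using (_⇔_)

FarApart : {n : ℕ} → Fin n → Fin n → Set
FarApart i j = (suc (toℕ i) < toℕ j) ⊎ (suc (toℕ j) < toℕ i)

data Walk {n : ℕ} {F : Set} (r : Fin n → F → F) (ok : Fin n → Set) : F → F → Set where
  here : ∀ {x} → Walk r ok x x
  step : ∀ {x y} (i : Fin n) → ok i → Walk r ok (r i x) y → Walk r ok x y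

AnyColour : {n : ℕ} → Fin n → Set
AnyColour _ = ⊤

-- An (n-1)-maniplex given by its flag graph: flags F, and for each colour i
-- the perfect matching r i (the i-adjacent flag).
record Maniplex (n : ℕ) : Set₁ where
  field
    Flag : Set
    r : Fin n → Flag → Flag
    r-invol : ∀ i x → r i (r i x) ≡ x
    r-noloop : ∀ i x → r i x ≢ x
    r-simple : ∀ i j x → i ≢ j → r i x ≢ r j x
    r-comm : ∀ i j x → FarApart i j → r i (r j (r i (r j x))) ≡ x
    connected : ∀ x y → Walk r AnyColour x y

module _ {n : ℕ} (M : Maniplex n) where
  open Maniplex M

  record Automorphism : Set where
    field
      to : Flag → Flag
      from : Flag → Flag
      from-to : ∀ x → from (to x) ≡ x
      to-from : ∀ x → to (from x) ≡ x
      preserves : ∀ i x → to (r i x) ≡ r i (to x)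

  SameOrbit : Flag → Flag → Set
  SameOrbit x y = Σ Automorphism λ φ → Automorphism.to φ x ≡ y

  ThreeOrbit : Set
  ThreeOrbit = Σ (Fin 3 → Flag) λ v →
    (∀ p q → p ≢ q → ¬ SameOrbit (v p) (v q)) ×
    (∀ y → ∃ λ p → SameOrbit (v p) y)

  -- x and y lie in the same j-face (component of the graph without j-edges)
  SameFace : Fin n → Flag → Flag → Set
  SameFace j x y = Walk r (λ i → i ≢ j) x y

  FaceTransitive : Fin n → Set
  FaceTransitive j = ∀ x y → Σ Automorphism λ φ → SameFace j (Automorphism.to φ x) y

  -- T(M) has an a-edge joining the orbits of x and y
  -- (used only for flags x, y in distinct orbits)
  OrbitEdge : Fin n → Flag → Flag → Set
  OrbitEdge a x y = Σ Flag λ f → SameOrbit x f × SameOrbit y (r a f)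

  UPair : Fin 3 → Fin 3 → Fin 3 → Fin 3 → Set
  UPair p q u v = (p ≡ u × q ≡ v) ⊎ (p ≡ v × q ≡ u)

  private
    v₁ v₂ v₃ : Fin 3
    v₁ = Fin.zero
    v₂ = Fin.suc Fin.zero
    v₃ = Fin.suc (Fin.suc Fin.zero)

  -- The flag orbits (the vertices of T(M)) can be named v₁ v₂ v₃ (via
  -- representatives) so that the non-semi edges of T(M) are exactly those
  -- prescribed by `spec`.
  HasTypeGraph : (Fin n → Fin 3 → Fin 3 → Set) → Set
  HasTypeGraph spec = Σ (Fin 3 → Flag) λ v →
    (∀ p q → p ≢ q → ¬ SameOrbit (v p) (v q)) ×
    (∀ y → ∃ λ p → SameOrbit (v p) y) ×
    (∀ a p q → p ≢ q → (OrbitEdge a (v p) (v q) ⇔ spec a p q))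

  Class3Pair : ℕ → Set
  Class3Pair k = (suc k < n) × HasTypeGraph (λ a p q →
    (UPair p q v₁ v₂ × toℕ a ≡ k) ⊎ (UPair p q v₂ v₃ × toℕ a ≡ suc k))

  Class3Single : ℕ → Set
  Class3Single k = (1 ≤ k) × (suc k < n) × HasTypeGraph (λ a p q →
    (UPair p q v₁ v₂ × toℕ a ≡ k) ⊎
    (UPair p q v₂ v₃ × (suc (toℕ a) ≡ k ⊎ toℕ a ≡ suc k)))

-- Choosing orbit representatives, the colours act on the three flag orbits by
-- involutions δ i, and walks in the flag graph project to walks of T(M) and lift
-- back along them.  Hence M is j-face-transitive iff T(M) stays connected once its
-- j-edges are deleted.  On three vertices this fails exactly when some orbit q₀
-- meets only j-edges.  Then T(M) is a path q₀ —j— p₁ —A— p₂, and as colours i with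
-- |i − j| ≥ 2 commute, the set A of colours joining p₁ and p₂ lies in {j − 1, j + 1};
-- the three nonempty possibilities for A are the classes 3^j, 3^{j,j+1}, 3^{j−1,j}.

module Submission where

open import Defs
open import Data.Nat using (ℕ; suc)
open import Data.Fin using (Fin; toℕ)
open import Data.Product using (∃; _×_)
open import Data.Sum using (_⊎_)
open import Relation.Nullary using (¬_)
open import Relation.Binary.PropositionalEquality using (_≡_)
open import Function.Bundles using (_⇔_)

open import Data.Nat using (zero; pred; _<_; _≤_; z≤n; s≤s) renaming (_≟_ to _ℕ≟_)
open import Data.Fin using (_≟_)
open import Data.Fin.Patterns using (0F; 1F; 2F)
open import Data.Fin.Properties using (toℕ-injective; toℕ<n; any?; all?; ¬∀⟶∃¬)
open import Data.Product using (_,_; proj₁; proj₂)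
open import Data.Sum using (inj₁; inj₂; [_,_]′)
import Data.Sum as Sum
open import Data.Empty using (⊥-elim)
open import Data.Unit using (tt)
open import Function using (_∘_; id)
open import Function.Bundles using (mk⇔; module Equivalence)
open import Function.Properties.Equivalence using () renaming (trans to ⇔-trans)
open import Relation.Nullary using (Dec; yes; no)
open import Relation.Nullary.Decidable using (_×-dec_; _⊎-dec_; _→-dec_; ¬?; toWitness; toWitnessFalse; False)
open import Relation.Binary.PropositionalEquality
  using (_≢_; refl; sym; trans; cong; subst; subst₂; ≢-sym; module ≡-Reasoning)

open Equivalence using (to; from)

≢⇒adjacent⊎farApart : ∀ m n → m ≢ n → (suc m ≡ n ⊎ m ≡ suc n) ⊎ (suc m < n ⊎ suc n < m)
≢⇒adjacent⊎farApart zero          zero          m≢n = ⊥-elim (m≢n refl)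
≢⇒adjacent⊎farApart zero          (suc zero)    _   = inj₁ (inj₁ refl)
≢⇒adjacent⊎farApart zero          (suc (suc n)) _   = inj₂ (inj₁ (s≤s (s≤s z≤n)))
≢⇒adjacent⊎farApart (suc zero)    zero          _   = inj₁ (inj₂ refl)
≢⇒adjacent⊎farApart (suc (suc m)) zero          _   = inj₂ (inj₂ (s≤s (s≤s z≤n)))
≢⇒adjacent⊎farApart (suc m)       (suc n)       m≢n =
  Sum.map (Sum.map (cong suc) (cong suc)) (Sum.map s≤s s≤s)
          (≢⇒adjacent⊎farApart m n (m≢n ∘ cong suc))

-- Opaque, since unfolding these decision-procedure proofs at neutral arguments
-- makes type checking blow up.
opaque
  fin3-cover : (a b c x : Fin 3) → a ≢ b → a ≢ c → b ≢ c → x ≡ a ⊎ x ≡ b ⊎ x ≡ c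
  fin3-cover = toWitness {a? = all? λ a → all? λ b → all? λ c → all? λ x →
    ¬? (a ≟ b) →-dec ¬? (a ≟ c) →-dec ¬? (b ≟ c) →-dec ((x ≟ a) ⊎-dec (x ≟ b) ⊎-dec (x ≟ c))} tt

  fin3-third : (a b : Fin 3) → ∃ λ c → c ≢ a × c ≢ b
  fin3-third = toWitness {a? = all? λ a → all? λ b → any? λ c → ¬? (c ≟ a) ×-dec ¬? (c ≟ b)} tt

module _ {n : ℕ} {F : Set} {r : Fin n → F → F} {ok : Fin n → Set} where

  infixr 5 _++_
  _++_ : ∀ {x y z} → Walk r ok x y → Walk r ok y z → Walk r ok x z
  here         ++ w′ = w′
  step i oki w ++ w′ = step i oki (w ++ w′)

  edge : ∀ {x} i → ok i → Walk r ok x (r i x)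
  edge i oki = step i oki here

  walk-preserves : {P : F → Set} → (∀ i {x} → ok i → P x → P (r i x)) →
                   ∀ {x y} → Walk r ok x y → P x → P y
  walk-preserves closed here         px = px
  walk-preserves closed (step i oki w) px = walk-preserves closed w (closed i oki px)

  walk-from-fixed : ∀ {x y} → (∀ i → ok i → r i x ≡ x) → Walk r ok x y → y ≡ x
  walk-from-fixed {x} fixed w = walk-preserves {P = _≡ x} closed w refl
    where
    closed : ∀ i {z} → ok i → z ≡ x → r i z ≡ x
    closed i oki refl = fixed i oki

  module _ (r-invol : ∀ i x → r i (r i x) ≡ x) where

    edge⁻¹ : ∀ {x} i → ok i → Walk r ok (r i x) x
    edge⁻¹ {x} i oki = step i oki (subst (λ y → Walk r ok y x) (sym (r-invol i x)) here)

    reverse : ∀ {x y} → Walk r ok x y → Walk r ok y x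
    reverse here           = here
    reverse (step i oki w) = reverse w ++ edge⁻¹ i oki

module _ {n : ℕ} {A B : Set} {r : Fin n → A → A} {s : Fin n → B → B} {ok : Fin n → Set}
         (h : A → B) (h-hom : ∀ i x → h (r i x) ≡ s i (h x)) where

  walk-map : ∀ {x y} → Walk r ok x y → Walk s ok (h x) (h y)
  walk-map here = here
  walk-map {y = y} (step {x} i oki w) =
    step i oki (subst (λ z → Walk s ok z (h y)) (h-hom i x) (walk-map w))

  walk-lift : ∀ {x p q} → h x ≡ p → Walk s ok p q → ∃ λ z → h z ≡ q × Walk r ok x z
  walk-lift hx≡p here = _ , hx≡p , here
  walk-lift {x} hx≡p (step i oki w) with walk-lift (trans (h-hom i x) (cong (s i) hx≡p)) w
  ... | z , hz≡q , w′ = z , hz≡q , step i oki w′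

-- Every vertex reaches 0F: 0F has a neighbour a, and the third vertex t has a
-- neighbour, which can only be 0F or a.
fin3-connected : ∀ {m} {s : Fin m → Fin 3 → Fin 3} {ok : Fin m → Set} →
                 (∀ i p → s i (s i p) ≡ p) → (∀ p → ∃ λ i → ok i × s i p ≢ p) →
                 ∀ p q → Walk s ok p q
fin3-connected {s = s} {ok} s-invol moves p q = toBase p ++ reverse s-invol (toBase q)
  where
  toBase : ∀ x → Walk s ok x 0F
  toBase x with moves 0F
  ... | i₀ , ok₀ , a≢0 with fin3-third 0F (s i₀ 0F)
  ... | t , t≢0 , t≢a with moves t
  ... | i₁ , ok₁ , t-moves = [ nearBase ∘ inj₁ , [ nearBase ∘ inj₂ , fromT ]′ ]′ (cover x)
    where
    cover : ∀ y → y ≡ 0F ⊎ y ≡ s i₀ 0F ⊎ y ≡ t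
    cover y = fin3-cover 0F (s i₀ 0F) t y (≢-sym a≢0) (≢-sym t≢0) (≢-sym t≢a)

    nearBase : ∀ {y} → y ≡ 0F ⊎ y ≡ s i₀ 0F → Walk s ok y 0F
    nearBase (inj₁ refl) = here
    nearBase (inj₂ refl) = edge⁻¹ s-invol i₀ ok₀

    fromT : x ≡ t → Walk s ok x 0F
    fromT refl = edge i₁ ok₁ ++ nearBase ([ inj₁ , [ inj₂ , ⊥-elim ∘ t-moves ]′ ]′ (cover (s i₁ x)))

module _ {n : ℕ} (M : Maniplex n) where
  open Maniplex M
  private module Aut = Automorphism

  id-aut : Automorphism M
  id-aut = record { to = id ; from = id ; from-to = λ _ → refl ; to-from = λ _ → refl
                  ; preserves = λ _ _ → refl }

  _∘-aut_ : Automorphism M → Automorphism M → Automorphism M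
  ψ ∘-aut φ = record
    { to        = Aut.to ψ ∘ Aut.to φ
    ; from      = Aut.from φ ∘ Aut.from ψ
    ; from-to   = λ x → trans (cong (Aut.from φ) (Aut.from-to ψ (Aut.to φ x))) (Aut.from-to φ x)
    ; to-from   = λ x → trans (cong (Aut.to ψ) (Aut.to-from φ (Aut.from ψ x))) (Aut.to-from ψ x)
    ; preserves = λ i x → trans (cong (Aut.to ψ) (Aut.preserves φ i x)) (Aut.preserves ψ i (Aut.to φ x))
    }

  inverse-aut : Automorphism M → Automorphism M
  inverse-aut φ = record
    { to        = Aut.from φ
    ; from      = Aut.to φ
    ; from-to   = Aut.to-from φ
    ; to-from   = Aut.from-to φ
    ; preserves = λ i x → begin
        Aut.from φ (r i x)                          ≡⟨ cong (Aut.from φ ∘ r i) (sym (Aut.to-from φ x)) ⟩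
        Aut.from φ (r i (Aut.to φ (Aut.from φ x)))  ≡⟨ cong (Aut.from φ) (sym (Aut.preserves φ i (Aut.from φ x))) ⟩
        Aut.from φ (Aut.to φ (r i (Aut.from φ x)))  ≡⟨ Aut.from-to φ (r i (Aut.from φ x)) ⟩
        r i (Aut.from φ x)                          ∎
    }
    where open ≡-Reasoning

  sameOrbit-refl : ∀ {x} → SameOrbit M x x
  sameOrbit-refl = id-aut , refl

  sameOrbit-sym : ∀ {x y} → SameOrbit M x y → SameOrbit M y x
  sameOrbit-sym {x} (φ , φx≡y) = inverse-aut φ , trans (cong (Aut.from φ) (sym φx≡y)) (Aut.from-to φ x)

  sameOrbit-trans : ∀ {x y z} → SameOrbit M x y → SameOrbit M y z → SameOrbit M x z
  sameOrbit-trans (φ , φx≡y) (ψ , ψy≡z) = ψ ∘-aut φ , trans (cong (Aut.to ψ) φx≡y) ψy≡z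

  sameOrbit-r : ∀ {x y} i → SameOrbit M x y → SameOrbit M (r i x) (r i y)
  sameOrbit-r {x} i (φ , φx≡y) = φ , trans (Aut.preserves φ i x) (cong (r i) φx≡y)

  -- Flag orbits are labelled by Fin k through the transversal v; the colours act
  -- on labels by δ, and Walk δ is the walk relation of T(M).
  module Transversal {k : ℕ} (v : Fin k → Flag)
           (distinct : ∀ p q → p ≢ q → ¬ SameOrbit M (v p) (v q))
           (covering : ∀ x → ∃ λ p → SameOrbit M (v p) x) where

    orbit : Flag → Fin k
    orbit x = proj₁ (covering x)

    orbit-rep : ∀ x → SameOrbit M (v (orbit x)) x
    orbit-rep x = proj₂ (covering x)

    orbit-unique : ∀ {p x} → SameOrbit M (v p) x → orbit x ≡ p
    orbit-unique {p} {x} vp~x with orbit x ≟ p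
    ... | yes e = e
    ... | no ne = ⊥-elim (distinct _ _ ne (sameOrbit-trans (orbit-rep x) (sameOrbit-sym vp~x)))

    orbit-v : ∀ p → orbit (v p) ≡ p
    orbit-v p = orbit-unique sameOrbit-refl

    orbit≡⇒sameOrbit : ∀ {x y} → orbit x ≡ orbit y → SameOrbit M x y
    orbit≡⇒sameOrbit {x} {y} e =
      sameOrbit-trans (sameOrbit-sym (orbit-rep x)) (subst (λ p → SameOrbit M (v p) y) (sym e) (orbit-rep y))

    δ : Fin n → Fin k → Fin k
    δ i p = orbit (r i (v p))

    orbit-r : ∀ i x → orbit (r i x) ≡ δ i (orbit x)
    orbit-r i x = orbit-unique (sameOrbit-trans (orbit-rep (r i (v (orbit x)))) (sameOrbit-r i (orbit-rep x)))

    δ-invol : ∀ i p → δ i (δ i p) ≡ p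
    δ-invol i p = trans (sym (orbit-r i (r i (v p)))) (trans (cong orbit (r-invol i (v p))) (orbit-v p))

    δ-flip : ∀ {i p q} → δ i p ≡ q ⇔ δ i q ≡ p
    δ-flip {i} = mk⇔ flip flip
      where
      flip : ∀ {p q} → δ i p ≡ q → δ i q ≡ p
      flip {p} refl = δ-invol i p

    δ-comm : ∀ i j p → FarApart i j → δ i (δ j (δ i (δ j p))) ≡ p
    δ-comm i j p far = begin
      δ i (δ j (δ i (δ j p)))                 ≡⟨ sym (cong (δ i ∘ δ j) (orbit-r i (r j (v p)))) ⟩
      δ i (δ j (orbit (r i (r j (v p)))))     ≡⟨ sym (cong (δ i) (orbit-r j (r i (r j (v p))))) ⟩
      δ i (orbit (r j (r i (r j (v p)))))     ≡⟨ sym (orbit-r i (r j (r i (r j (v p))))) ⟩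
      orbit (r i (r j (r i (r j (v p)))))     ≡⟨ cong orbit (r-comm i j (v p) far) ⟩
      orbit (v p)                             ≡⟨ orbit-v p ⟩
      p                                       ∎
      where open ≡-Reasoning

    orbitEdge⇔δ : ∀ {a p q} → OrbitEdge M a (v p) (v q) ⇔ δ a p ≡ q
    orbitEdge⇔δ {a} {p} {q} = mk⇔
      (λ { (f , vp~f , vq~raf) → begin
             δ a p             ≡⟨ cong (δ a) (sym (orbit-unique vp~f)) ⟩
             δ a (orbit f)     ≡⟨ sym (orbit-r a f) ⟩
             orbit (r a f)     ≡⟨ orbit-unique vq~raf ⟩
             q                 ∎ })
      (λ δap≡q → v p , sameOrbit-refl ,
         subst (λ z → SameOrbit M (v z) (r a (v p))) δap≡q (orbit-rep (r a (v p))))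
      where open ≡-Reasoning

    flagWalk⇒orbitWalk : ∀ {ok : Fin n → Set} {x y} → Walk r ok x y → Walk δ ok (orbit x) (orbit y)
    flagWalk⇒orbitWalk = walk-map orbit orbit-r

    orbitWalk : ∀ p q → Walk δ AnyColour p q
    orbitWalk p q = subst₂ (Walk δ AnyColour) (orbit-v p) (orbit-v q) (flagWalk⇒orbitWalk (connected (v p) (v q)))

    OrbitsConnected : Fin n → Set
    OrbitsConnected j = ∀ p q → Walk δ (_≢ j) p q

    faceTransitive⇔orbitsConnected : ∀ j → FaceTransitive M j ⇔ OrbitsConnected j
    faceTransitive⇔orbitsConnected j = mk⇔ ⇒ ⇐
      where
      ⇒ : FaceTransitive M j → OrbitsConnected j
      ⇒ ft p q with ft (v p) (v q)
      ... | φ , w = subst₂ (Walk δ (_≢ j)) (orbit-unique (φ , refl)) (orbit-v q) (flagWalk⇒orbitWalk w)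

      ⇐ : OrbitsConnected j → FaceTransitive M j
      ⇐ conn x y with walk-lift orbit orbit-r refl (conn (orbit y) (orbit x))
      ... | z , z~x , w with orbit≡⇒sameOrbit (sym z~x)
      ... | φ , φx≡z = φ , subst (λ f → SameFace M j f y) (sym φx≡z) (reverse r-invol w)

    Isolated : Fin n → Fin k → Set
    Isolated j q = ∀ a → a ≢ j → δ a q ≡ q

    isolated? : ∀ j q → Dec (Isolated j q)
    isolated? j q = all? λ a → ¬? (a ≟ j) →-dec (δ a q ≟ q)

    ¬isolated⇒moved : ∀ {j q} → ¬ Isolated j q → ∃ λ a → a ≢ j × δ a q ≢ q
    ¬isolated⇒moved {j} {q} ¬iso with ¬∀⟶∃¬ n _ (λ a → ¬? (a ≟ j) →-dec (δ a q ≟ q)) ¬iso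
    ... | a , ¬fixes = a , (λ a≡j → ¬fixes (λ a≢j → ⊥-elim (a≢j a≡j))) , (λ moved → ¬fixes (λ _ → moved))

    isolated⇒¬orbitsConnected : ∀ {j q q′} → Isolated j q → q′ ≢ q → ¬ OrbitsConnected j
    isolated⇒¬orbitsConnected isolated q′≢q conn = q′≢q (walk-from-fixed isolated (conn _ _))

  PathSpec : (C₁₂ C₂₃ : Fin n → Set) → Fin n → Fin 3 → Fin 3 → Set
  PathSpec C₁₂ C₂₃ a p q = (UPair M p q 0F 1F × C₁₂ a) ⊎ (UPair M p q 1F 2F × C₂₃ a)

  pathSpec-at-v₁ : ∀ {C₁₂ C₂₃} a q → PathSpec C₁₂ C₂₃ a 0F q → C₁₂ a
  pathSpec-at-v₁ _ _ (inj₁ (_ , c))               = c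
  pathSpec-at-v₁ _ _ (inj₂ (inj₁ (() , _) , _))
  pathSpec-at-v₁ _ _ (inj₂ (inj₂ (() , _) , _))

  pathSpec-at-v₃ : ∀ {C₁₂ C₂₃} a q → PathSpec C₁₂ C₂₃ a 2F q → C₂₃ a
  pathSpec-at-v₃ _ _ (inj₁ (inj₁ (() , _) , _))
  pathSpec-at-v₃ _ _ (inj₁ (inj₂ (() , _) , _))
  pathSpec-at-v₃ _ _ (inj₂ (_ , c))               = c

  typeGraph⇒¬faceTransitive : ∀ {spec} → HasTypeGraph M spec → ∀ j q₀ →
    (∀ a q → spec a q₀ q → toℕ a ≡ toℕ j) → ¬ FaceTransitive M j
  typeGraph⇒¬faceTransitive (v , distinct , covering , edges) j q₀ only-j ft =
    isolated⇒¬orbitsConnected isolated (proj₁ (proj₂ (fin3-third q₀ q₀))) (to (faceTransitive⇔orbitsConnected j) ft)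
    where
    open Transversal v distinct covering
    isolated : Isolated j q₀
    isolated a a≢j with δ a q₀ ≟ q₀
    ... | yes fixed = fixed
    ... | no moved  = ⊥-elim (a≢j (toℕ-injective
          (only-j a _ (to (edges a q₀ _ (≢-sym moved)) (from orbitEdge⇔δ refl)))))

  pathTypeGraph⇒¬faceTransitive-v₁ : ∀ {C₁₂ C₂₃} → HasTypeGraph M (PathSpec C₁₂ C₂₃) → ∀ j →
    (∀ a → C₁₂ a → toℕ a ≡ toℕ j) → ¬ FaceTransitive M j
  pathTypeGraph⇒¬faceTransitive-v₁ {C₁₂} {C₂₃} tg j only-j =
    typeGraph⇒¬faceTransitive tg j 0F (λ a q → only-j a ∘ pathSpec-at-v₁ {C₁₂} {C₂₃} a q)

  pathTypeGraph⇒¬faceTransitive-v₃ : ∀ {C₁₂ C₂₃} → HasTypeGraph M (PathSpec C₁₂ C₂₃) → ∀ j →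
    (∀ a → C₂₃ a → toℕ a ≡ toℕ j) → ¬ FaceTransitive M j
  pathTypeGraph⇒¬faceTransitive-v₃ {C₁₂} {C₂₃} tg j only-j =
    typeGraph⇒¬faceTransitive tg j 2F (λ a q → only-j a ∘ pathSpec-at-v₃ {C₁₂} {C₂₃} a q)

  module ThreeOrbits (v : Fin 3 → Flag)
           (distinct : ∀ p q → p ≢ q → ¬ SameOrbit M (v p) (v q))
           (covering : ∀ x → ∃ λ p → SameOrbit M (v p) x) where
    open Transversal v distinct covering

    orbitsConnected⊎isolated : ∀ j → OrbitsConnected j ⊎ ∃ (Isolated j)
    orbitsConnected⊎isolated j with any? (isolated? j)
    ... | yes isolated = inj₂ isolated
    ... | no ¬isolated = inj₁ (fin3-connected δ-invol (λ q → ¬isolated⇒moved (¬isolated ∘ (q ,_))))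

    pathTypeGraph : ∀ {C₁₂ C₂₃ : Fin n → Set} (u₁ u₂ u₃ : Fin 3) →
      u₁ ≢ u₂ → u₁ ≢ u₃ → u₂ ≢ u₃ →
      (∀ a → δ a u₁ ≡ u₂ ⇔ C₁₂ a) → (∀ a → δ a u₁ ≢ u₃) → (∀ a → δ a u₂ ≡ u₃ ⇔ C₂₃ a) →
      HasTypeGraph M (PathSpec C₁₂ C₂₃)
    pathTypeGraph {C₁₂} {C₂₃} u₁ u₂ u₃ u₁≢u₂ u₁≢u₃ u₂≢u₃ E₁₂ N₁₃ E₂₃ =
      v ∘ u , (λ p q → distinct (u p) (u q) ∘ u-injective p q) , covering′ ,
      (λ a p q p≢q → ⇔-trans orbitEdge⇔δ (table a p q p≢q))
      where
      u : Fin 3 → Fin 3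
      u 0F = u₁
      u 1F = u₂
      u 2F = u₃

      u-injective : ∀ p q → p ≢ q → u p ≢ u q
      u-injective 0F 0F p≢q = ⊥-elim (p≢q refl)
      u-injective 0F 1F _   = u₁≢u₂
      u-injective 0F 2F _   = u₁≢u₃
      u-injective 1F 0F _   = ≢-sym u₁≢u₂
      u-injective 1F 1F p≢q = ⊥-elim (p≢q refl)
      u-injective 1F 2F _   = u₂≢u₃
      u-injective 2F 0F _   = ≢-sym u₁≢u₃
      u-injective 2F 1F _   = ≢-sym u₂≢u₃
      u-injective 2F 2F p≢q = ⊥-elim (p≢q refl)

      covering′ : ∀ x → ∃ λ p → SameOrbit M (v (u p)) x
      covering′ x with fin3-cover u₁ u₂ u₃ (orbit x) u₁≢u₂ u₁≢u₃ u₂≢u₃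
      ... | inj₁ e          = 0F , orbit≡⇒sameOrbit (trans (orbit-v u₁) (sym e))
      ... | inj₂ (inj₁ e)   = 1F , orbit≡⇒sameOrbit (trans (orbit-v u₂) (sym e))
      ... | inj₂ (inj₂ e)   = 2F , orbit≡⇒sameOrbit (trans (orbit-v u₃) (sym e))

      upair? : ∀ p q u w → Dec (UPair M p q u w)
      upair? p q u w = ((p ≟ u) ×-dec (q ≟ w)) ⊎-dec ((p ≟ w) ×-dec (q ≟ u))

      ¬upair : ∀ {p q u w} {_ : False (upair? p q u w)} → ¬ UPair M p q u w
      ¬upair {p} {q} {u} {w} {f} = toWitnessFalse {a? = upair? p q u w} f

      edge₁₂ : ∀ {X a p q} → UPair M p q 0F 1F → ¬ UPair M p q 1F 2F →
               X ⇔ C₁₂ a → X ⇔ PathSpec C₁₂ C₂₃ a p q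
      edge₁₂ up ¬up X⇔C = mk⇔ (λ x → inj₁ (up , to X⇔C x))
        [ from X⇔C ∘ proj₂ , ⊥-elim ∘ ¬up ∘ proj₁ ]′

      edge₂₃ : ∀ {X a p q} → ¬ UPair M p q 0F 1F → UPair M p q 1F 2F →
               X ⇔ C₂₃ a → X ⇔ PathSpec C₁₂ C₂₃ a p q
      edge₂₃ ¬up up X⇔C = mk⇔ (λ x → inj₂ (up , to X⇔C x))
        [ ⊥-elim ∘ ¬up ∘ proj₁ , from X⇔C ∘ proj₂ ]′

      no-edge : ∀ {X a p q} → ¬ UPair M p q 0F 1F → ¬ UPair M p q 1F 2F →
                ¬ X → X ⇔ PathSpec C₁₂ C₂₃ a p q
      no-edge ¬up₁₂ ¬up₂₃ ¬x = mk⇔ (⊥-elim ∘ ¬x) [ ⊥-elim ∘ ¬up₁₂ ∘ proj₁ , ⊥-elim ∘ ¬up₂₃ ∘ proj₁ ]′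

      table : ∀ a p q → p ≢ q → δ a (u p) ≡ u q ⇔ PathSpec C₁₂ C₂₃ a p q
      table a 0F 1F _   = edge₁₂ (inj₁ (refl , refl)) ¬upair (E₁₂ a)
      table a 1F 0F _   = edge₁₂ (inj₂ (refl , refl)) ¬upair (⇔-trans δ-flip (E₁₂ a))
      table a 1F 2F _   = edge₂₃ ¬upair (inj₁ (refl , refl)) (E₂₃ a)
      table a 2F 1F _   = edge₂₃ ¬upair (inj₂ (refl , refl)) (⇔-trans δ-flip (E₂₃ a))
      table a 0F 2F _   = no-edge ¬upair ¬upair (N₁₃ a)
      table a 2F 0F _   = no-edge ¬upair ¬upair (N₁₃ a ∘ to δ-flip)
      table a 0F 0F p≢q = ⊥-elim (p≢q refl)
      table a 1F 1F p≢q = ⊥-elim (p≢q refl)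
      table a 2F 2F p≢q = ⊥-elim (p≢q refl)

    Classes : Fin n → Set
    Classes j = Class3Single M (toℕ j) ⊎ Class3Pair M (toℕ j) ⊎ ∃ λ k → suc k ≡ toℕ j × Class3Pair M k

    -- An orbit q₀ whose only edge in T(M) has colour j; then T(M) is the path
    -- q₀ —j— p₁ —A— p₂, where A is the set of colours joining p₁ to p₂.
    module IsolatedOrbit (j : Fin n) (q₀ : Fin 3) (isolated : Isolated j q₀) where

      p₁ : Fin 3
      p₁ = δ j q₀

      p₁≢q₀ : p₁ ≢ q₀
      p₁≢q₀ p₁≡q₀ with fin3-third q₀ q₀
      ... | t , t≢q₀ , _ = t≢q₀ (walk-from-fixed fixed (orbitWalk q₀ t))
        where
        fixed : ∀ i → AnyColour i → δ i q₀ ≡ q₀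
        fixed i _ with i ≟ j
        ... | yes refl = p₁≡q₀
        ... | no i≢j   = isolated i i≢j

      p₂ : Fin 3
      p₂ = proj₁ (fin3-third q₀ p₁)

      p₂≢q₀ : p₂ ≢ q₀
      p₂≢q₀ = proj₁ (proj₂ (fin3-third q₀ p₁))

      p₂≢p₁ : p₂ ≢ p₁
      p₂≢p₁ = proj₂ (proj₂ (fin3-third q₀ p₁))

      δ-q₀-p₁ : ∀ {a} → δ a q₀ ≡ p₁ ⇔ toℕ a ≡ toℕ j
      δ-q₀-p₁ {a} = mk⇔ ⇒ (λ a≡j → subst (λ b → δ b q₀ ≡ p₁) (sym (toℕ-injective a≡j)) refl)
        where
        ⇒ : δ a q₀ ≡ p₁ → toℕ a ≡ toℕ j
        ⇒ e with a ≟ j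
        ... | yes refl = refl
        ... | no a≢j   = ⊥-elim (p₁≢q₀ (trans (sym e) (isolated a a≢j)))

      δ-q₀≢p₂ : ∀ a → δ a q₀ ≢ p₂
      δ-q₀≢p₂ a e with a ≟ j
      ... | yes refl = p₂≢p₁ (sym e)
      ... | no a≢j   = p₂≢q₀ (trans (sym e) (isolated a a≢j))

      δj-p₂ : δ j p₂ ≡ p₂
      δj-p₂ with fin3-cover q₀ p₁ p₂ (δ j p₂) (≢-sym p₁≢q₀) (≢-sym p₂≢q₀) (≢-sym p₂≢p₁)
      ... | inj₁ e        = ⊥-elim (p₂≢p₁ (sym (to δ-flip e)))
      ... | inj₂ (inj₁ e) = ⊥-elim (p₂≢q₀ (trans (sym (to δ-flip e)) (δ-invol j q₀)))
      ... | inj₂ (inj₂ e) = e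

      A : Fin n → Set
      A a = δ a p₁ ≡ p₂

      A⇒≢j : ∀ {a} → A a → a ≢ j
      A⇒≢j e refl = p₂≢q₀ (trans (sym e) (δ-invol j q₀))

      A⇒¬farApart : ∀ {a} → A a → ¬ FarApart a j
      A⇒¬farApart {a} e far = p₁≢q₀ (begin
        p₁                       ≡⟨ sym (to δ-flip e) ⟩
        δ a p₂                   ≡⟨ cong (δ a) (sym δj-p₂) ⟩
        δ a (δ j p₂)             ≡⟨ cong (δ a ∘ δ j) (sym e) ⟩
        δ a (δ j (δ a p₁))       ≡⟨ δ-comm a j q₀ far ⟩
        q₀                       ∎)
        where open ≡-Reasoning

      A⇒adjacent : ∀ {a} → A a → suc (toℕ a) ≡ toℕ j ⊎ toℕ a ≡ suc (toℕ j)
      A⇒adjacent e = [ id , ⊥-elim ∘ A⇒¬farApart e ]′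
        (≢⇒adjacent⊎farApart _ _ (A⇒≢j e ∘ toℕ-injective))

      A-toℕ : ∀ {a b} → A b → toℕ a ≡ toℕ b → A a
      A-toℕ Ab a≡b = subst A (sym (toℕ-injective a≡b)) Ab

      -- Otherwise {q₀, p₁} would be closed under every colour.
      A-nonempty : ¬ (∀ a → ¬ A a)
      A-nonempty ¬A = walk-preserves {P = _≢ p₂} closed (orbitWalk q₀ p₂) (≢-sym p₂≢q₀) refl
        where
        closed : ∀ i {x} → AnyColour i → x ≢ p₂ → δ i x ≢ p₂
        closed i {x} _ x≢p₂ with fin3-cover q₀ p₁ p₂ x (≢-sym p₁≢q₀) (≢-sym p₂≢q₀) (≢-sym p₂≢p₁)
        ... | inj₁ refl          = δ-q₀≢p₂ i
        ... | inj₂ (inj₁ refl)   = ¬A i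
        ... | inj₂ (inj₂ x≡p₂)   = ⊥-elim (x≢p₂ x≡p₂)

      Lower Upper : Fin n → Set
      Lower a = A a × suc (toℕ a) ≡ toℕ j
      Upper a = A a × toℕ a ≡ suc (toℕ j)

      class3Single : ∃ Lower → ∃ Upper → Class3Single M (toℕ j)
      class3Single (a₋ , A₋ , e₋) (a₊ , A₊ , e₊) =
        subst (1 ≤_) e₋ (s≤s z≤n) , subst (_< n) e₊ (toℕ<n a₊) ,
        pathTypeGraph q₀ p₁ p₂ (≢-sym p₁≢q₀) (≢-sym p₂≢q₀) (≢-sym p₂≢p₁) (λ _ → δ-q₀-p₁) δ-q₀≢p₂
          (λ _ → mk⇔ A⇒adjacent [ (λ e → A-toℕ A₋ (cong pred (trans e (sym e₋))))
                                , (λ e → A-toℕ A₊ (trans e (sym e₊))) ]′)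

      class3Pair-j : ¬ ∃ Lower → ∃ Upper → Class3Pair M (toℕ j)
      class3Pair-j ¬lower (a₊ , A₊ , e₊) =
        subst (_< n) e₊ (toℕ<n a₊) ,
        pathTypeGraph q₀ p₁ p₂ (≢-sym p₁≢q₀) (≢-sym p₂≢q₀) (≢-sym p₂≢p₁) (λ _ → δ-q₀-p₁) δ-q₀≢p₂
          (λ a → mk⇔ (λ Aa → [ (λ e → ⊥-elim (¬lower (a , Aa , e))) , id ]′ (A⇒adjacent Aa))
                     (λ e → A-toℕ A₊ (trans e (sym e₊))))

      class3Pair-below : ∃ Lower → ¬ ∃ Upper → ∃ λ k → suc k ≡ toℕ j × Class3Pair M k
      class3Pair-below (a₋ , A₋ , e₋) ¬upper =
        toℕ a₋ , e₋ , subst (_< n) (sym e₋) (toℕ<n j) ,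
        pathTypeGraph p₂ p₁ q₀ p₂≢p₁ p₂≢q₀ p₁≢q₀
          (λ a → ⇔-trans δ-flip
            (mk⇔ (λ Aa → [ (λ e → cong pred (trans e (sym e₋))) , (λ e → ⊥-elim (¬upper (a , Aa , e))) ]′
                            (A⇒adjacent Aa))
                 (A-toℕ A₋)))
          (λ a → δ-q₀≢p₂ a ∘ to δ-flip)
          (λ a → ⇔-trans δ-flip (⇔-trans δ-q₀-p₁ (mk⇔ (λ e → trans e (sym e₋)) (λ e → trans e e₋))))

      classes : Classes j
      classes with any? (λ a → (δ a p₁ ≟ p₂) ×-dec (suc (toℕ a) ℕ≟ toℕ j))
                 | any? (λ a → (δ a p₁ ≟ p₂) ×-dec (toℕ a ℕ≟ suc (toℕ j)))
      ... | yes lower | yes upper = inj₁ (class3Single lower upper)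
      ... | no ¬lower | yes upper = inj₂ (inj₁ (class3Pair-j ¬lower upper))
      ... | yes lower | no ¬upper = inj₂ (inj₂ (class3Pair-below lower ¬upper))
      ... | no ¬lower | no ¬upper = ⊥-elim (A-nonempty λ a Aa →
              [ (λ e → ¬lower (a , Aa , e)) , (λ e → ¬upper (a , Aa , e)) ]′ (A⇒adjacent Aa))

proposition4p2 : (n : ℕ) (M : Maniplex n) → ThreeOrbit M → (j : Fin n) →
    FaceTransitive M j ⇔
      (¬ (Class3Single M (toℕ j) ⊎ Class3Pair M (toℕ j) ⊎
         (∃ λ k → suc k ≡ toℕ j × Class3Pair M k)))
proposition4p2 n M (v , distinct , covering) j = mk⇔ ⇒ ⇐
  where
  open Transversal M v distinct covering
  open ThreeOrbits M v distinct covering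

  ⇒ : FaceTransitive M j → ¬ Classes j
  ⇒ ft (inj₁ (_ , _ , tg))                = pathTypeGraph⇒¬faceTransitive-v₁ M tg j (λ _ → id) ft
  ⇒ ft (inj₂ (inj₁ (_ , tg)))             = pathTypeGraph⇒¬faceTransitive-v₁ M tg j (λ _ → id) ft
  ⇒ ft (inj₂ (inj₂ (_ , k+1≡j , _ , tg))) =
    pathTypeGraph⇒¬faceTransitive-v₃ M tg j (λ _ a≡k+1 → trans a≡k+1 k+1≡j) ft

  ⇐ : ¬ Classes j → FaceTransitive M j
  ⇐ ¬classes with orbitsConnected⊎isolated j
  ... | inj₁ connected       = from (faceTransitive⇔orbitsConnected j) connected
  ... | inj₂ (q₀ , isolated) = ⊥-elim (¬classes (IsolatedOrbit.classes j q₀ isolated))
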